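{- For every integer $k\ge 0$ there is a biconnected series-parallel graph $G_k$ such that $\mathrm{evc}(G_k)-\mathrm{vc}(G_k)\ge k$ and $\mathrm{evc}(G_k)\ge\left(2-\frac{2}{k+2}\right)\mathrm{vc}(G_k)$.
   Context: Series-parallel graphs are graphs with two distinguished vertices (source $s$, sink $t$) defined recursively: a single edge is series-parallel; the series composition of $G_1,G_2$ identifies $t_1$ with $s_2$ (new source $s_1$, sink $t_2$); the parallel composition identifies $s_1$ with $s_2$ and $t_1$ with $t_2$. $\mathrm{vc}(G)$ is the vertex cover number. For a vertex cover $U$ of $G=(V,E)$ and an edge $e=vw$, a defense of $U$ against $e$ is a one-to-one map $\phi:U\to V$ with $\phi(u)\in N[u]$ (closed neighborhood) for all $u\in U$ and $\phi(v)=w$ (with $v\in U$) or $\phi(w)=v$ (with $w\in U$). An eternal vertex cover class is a family $\mathcal{U}$ of vertex covers of equal cardinality (its size) such that for every $U\in\mathcal{U}$ and every edge $e$ there is a defense $\phi$ of $U$ against $e$ with $\phi(U)\in\mathcal{U}$; $\mathrm{evc}(G)$ is the minimum size of such a class. -}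

module Defs where

open import Data.Nat using (ℕ; zero; suc; _+_; _∸_; _≤_)
open import Data.Fin using (Fin; toℕ)
open import Data.Fin.Subset using (Subset; _∈_; ∣_∣)
open import Data.List using (List; []; _∷_; map; _++_)
import Data.List.Membership.Propositional as LM
open import Data.Product using (Σ; ∃; _×_; _,_)
import Data.Product as P
open import Data.Sum using (_⊎_)
open import Data.Unit using (⊤)
open import Relation.Binary.PropositionalEquality using (_≡_; _≢_)

record Graph : Set where
  field
    n : ℕ
    E : List (ℕ × ℕ)
open Graph public

Adj : (G : Graph) → Fin (n G) → Fin (n G) → Set
Adj G u v = LM._∈_ (toℕ u , toℕ v) (E G) ⊎ LM._∈_ (toℕ v , toℕ u) (E G)

InN : (G : Graph) → Fin (n G) → Fin (n G) → Set
InN G u x = x ≡ u ⊎ Adj G u x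

-- Series-parallel graphs, built by the recursive definition.
-- The realisation of a term has vertices 0 .. size-1, source 0, sink 1.

data SP : Set where
  edge : SP
  ser  : SP → SP → SP   -- series composition (sink of 1st = source of 2nd)
  par  : SP → SP → SP

size : SP → ℕ
size edge      = 2
size (ser a b) = size a + size b ∸ 1
size (par a b) = size a + size b ∸ 2

relabel : (ℕ → ℕ) → List (ℕ × ℕ) → List (ℕ × ℕ)
relabel f = map (P.map f f)

-- series: first graph: source ↦ 0, sink ↦ 2 (middle vertex), interior shifted by 1
serL : ℕ → ℕ
serL zero = 0
serL (suc zero) = 2
serL (suc (suc v)) = 3 + v

-- series: second graph (first has n1 vertices): source ↦ 2, sink ↦ 1,
-- interior 2+v ↦ n1+1+v
serR : ℕ → ℕ → ℕ
serR n1 zero = 2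
serR n1 (suc zero) = 1
serR n1 (suc (suc v)) = n1 + 1 + v

-- parallel: second graph: source ↦ 0, sink ↦ 1, interior 2+v ↦ n1+v
parR : ℕ → ℕ → ℕ
parR n1 zero = 0
parR n1 (suc zero) = 1
parR n1 (suc (suc v)) = n1 + v

edges : SP → List (ℕ × ℕ)
edges edge      = (0 , 1) ∷ []
edges (ser a b) = relabel serL (edges a) ++ relabel (serR (size a)) (edges b)
edges (par a b) = edges a ++ relabel (parR (size a)) (edges b)

spGraph : SP → Graph
spGraph t = record { n = size t ; E = edges t }

data Reach (G : Graph) (P : Fin (n G) → Set) : Fin (n G) → Fin (n G) → Set where
  here : ∀ {u} → P u → Reach G P u u
  step : ∀ {u v w} → P u → Adj G u v → Reach G P v w → Reach G P u w

Connected : Graph → Set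
Connected G = ∀ u v → Reach G (λ _ → ⊤) u v

Biconnected : Graph → Set
Biconnected G = Connected G ×
  (∀ x u v → u ≢ x → v ≢ x → Reach G (λ y → y ≢ x) u v)

IsVertexCover : (G : Graph) → Subset (n G) → Set
IsVertexCover G U = ∀ u v → Adj G u v → u ∈ U ⊎ v ∈ U

IsVCNumber : Graph → ℕ → Set
IsVCNumber G k =
  (Σ (Subset (n G)) λ U → IsVertexCover G U × ∣ U ∣ ≡ k) ×
  (∀ U → IsVertexCover G U → k ≤ ∣ U ∣)

Defense : (G : Graph) → Subset (n G) → Fin (n G) → Fin (n G) →
          (Fin (n G) → Fin (n G)) → Set
Defense G U v w φ =
  (∀ u → u ∈ U → InN G u (φ u)) ×
  (∀ u u' → u ∈ U → u' ∈ U → φ u ≡ φ u' → u ≡ u') ×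
  ((v ∈ U × φ v ≡ w) ⊎ (w ∈ U × φ w ≡ v))

IsImage : ∀ {m} → Subset m → (Fin m → Fin m) → Subset m → Set
IsImage {m} U φ U' =
  ∀ x → (x ∈ U' → ∃ λ u → u ∈ U × φ u ≡ x) × ((∃ λ u → u ∈ U × φ u ≡ x) → x ∈ U')

IsEVCClass : (G : Graph) → ℕ → (Subset (n G) → Set) → Set
IsEVCClass G k 𝒰 =
  (∃ λ U → 𝒰 U) ×
  (∀ U → 𝒰 U → IsVertexCover G U × ∣ U ∣ ≡ k) ×
  (∀ U → 𝒰 U → ∀ v w → Adj G v w →
     ∃ λ φ → Defense G U v w φ × (∃ λ U' → 𝒰 U' × IsImage U φ U'))

IsEVCNumber : Graph → ℕ → Set₁
IsEVCNumber G k =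
  (∃ λ 𝒰 → IsEVCClass G k 𝒰) ×
  (∀ j 𝒰 → IsEVCClass G j 𝒰 → k ≤ j)

module Submission where

-- Q ≥ 2 gadgets are joined in parallel between a source and a sink; a gadget is a path
-- source – link – hub followed by m + 1 parallel paths hub – leaf – sink. The poles and the
-- hubs form a minimum vertex cover, so vc = Q + 2. Guarding the sink, every hub, every link
-- and one leaf, with possibly the guard of one link moved onto the source, gives an eternal
-- vertex cover class of size 2Q + 2: each attack is answered by shifting guards along at most
-- two short paths. Conversely, when m + 1 ≥ 2Q + 2 a class of smaller size must guard the sink
-- and every hub (otherwise it guards all leaves of a gadget), and attacking a free leaf shows
-- that it also guards a second vertex in every gadget. Counting, the source is never guarded,
-- yet an attack on a source–link edge pushes a guard onto it. With Q = k + 2 the gap is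
-- evc − vc = k + 2 and the ratio is (2k + 6)/(k + 4) ≥ 2 − 2/(k + 2).

open import Defs

open import Data.Empty using (⊥; ⊥-elim)
open import Data.Fin using (Fin; zero; suc; toℕ; cast; combine; remQuot)
import Data.Fin as Fin
open import Data.Fin.Properties
  using (toℕ-injective; toℕ-cast; cast-involutive; toℕ-combine; remQuot-combine; combine-remQuot; ¬∀⟶∃¬; 0≢1+n)
open import Data.Fin.Subset using (Subset; inside; outside; _∈_; _∉_; ∣_∣; ⁅_⁆; _∪_) renaming (⊥ to ∅)
open import Data.Fin.Subset.Properties
  using ( _∈?_; ∉⊥; x∈⁅x⁆; x∈⁅y⁆⇒x≡y; x∈p∪q⁺; x∈p∪q⁻; ∪-identityˡ; ∣⊥∣≡0
        ; x∈p∧x≢y⇒x∈p-y; x∈p⇒∣p-x∣<∣p∣)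
open import Data.Integer using (+_; +≤+)
import Data.Integer as ℤ
open import Data.Integer.Properties using (pos-*)
open import Data.List using (List; []; _∷_; _++_; map; foldr; length; tabulate)
open import Data.List.Properties using (length-map; length-++; length-tabulate)
open import Data.List.Membership.Propositional using () renaming (_∈_ to _∈ₗ_; _∉_ to _∉ₗ_)
open import Data.List.Membership.Propositional.Properties
  using (∈-map⁺; ∈-map⁻; ∈-++⁺ˡ; ∈-++⁺ʳ; ∈-++⁻; ∈-tabulate⁺; ∈-tabulate⁻)
open import Data.List.Relation.Binary.Disjoint.Propositional using (Disjoint)
open import Data.List.Relation.Unary.All as All using (All; []; _∷_)
import Data.List.Relation.Unary.All.Properties as All
open import Data.List.Relation.Unary.AllPairs using ([]; _∷_)
open import Data.List.Relation.Unary.Any using (here; there; any?)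
open import Data.List.Relation.Unary.Unique.Propositional using (Unique)
import Data.List.Relation.Unary.Unique.Propositional.Properties as Unique
open import Data.Nat using (ℕ; zero; suc; _+_; _∸_; _≤_; _<_; _≤?_; z≤n; s≤s)
import Data.Nat as ℕ
open import Data.Nat.Properties
  using (≤-refl; ≤-trans; ≤-reflexive; n≮n; <⇒≱; ≰⇒>; m≤m+n; +-assoc; +-suc; +-identityʳ; *-comm)
open import Data.Nat.Tactic.RingSolver using (solve-∀)
open import Data.Product using (Σ; ∃; ∃₂; _×_; _,_; proj₁; proj₂; uncurry)
import Data.Product as Product
open import Data.Rational using (_/_; _-_; _*_; toℚᵘ; fromℚᵘ) renaming (_≤_ to _≤ℚ_)
import Data.Rational as ℚ
open import Data.Rational.Properties
  using (toℚᵘ-cancel-≤; toℚᵘ-homo-*; toℚᵘ-homo-+; toℚᵘ-homo‿-; toℚᵘ-fromℚᵘ)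
import Data.Rational.Unnormalised as ℚᵘ
import Data.Rational.Unnormalised.Properties as ℚᵘ
open import Data.Sum using (_⊎_; inj₁; inj₂)
import Data.Sum as Sum
open import Data.Unit using (⊤; tt)
import Data.Vec as Vec
open import Function using (_∘_; const)
open import Relation.Binary.Definitions using (DecidableEquality)
open import Relation.Binary.PropositionalEquality
open import Relation.Nullary using (¬_; yes; no; _×-dec_)
import Relation.Nullary.Decidable as Dec

module _ {G : Graph} where

  adj-sym : ∀ {u v} → Adj G u v → Adj G v u
  adj-sym (inj₁ e) = inj₂ e
  adj-sym (inj₂ e) = inj₁ e

  reach-trans : ∀ {P u v w} → Reach G P u v → Reach G P v w → Reach G P u w
  reach-trans (here _)       r = r
  reach-trans (step p uv r′) r = step p uv (reach-trans r′ r)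

  reach-source : ∀ {P u v} → Reach G P u v → P u
  reach-source (here p)     = p
  reach-source (step p _ _) = p

  reach-sym : ∀ {P u v} → Reach G P u v → Reach G P v u
  reach-sym (here p)      = here p
  reach-sym (step p uv r) = reach-trans (reach-sym r) (step (reach-source r) (adj-sym uv) (here p))

  reach-map : ∀ {P Q : Fin (n G) → Set} {u v} → (∀ {x} → P x → Q x) → Reach G P u v → Reach G Q u v
  reach-map f (here p)      = here (f p)
  reach-map f (step p uv r) = step (f p) uv (reach-map f r)

module _ {n : ℕ} where

  fromList : List (Fin n) → Subset n
  fromList = foldr (λ x p → ⁅ x ⁆ ∪ p) ∅

  ∈-fromList⁺ : ∀ {x xs} → x ∈ₗ xs → x ∈ fromList xs
  ∈-fromList⁺ {x} (here refl) = x∈p∪q⁺ (inj₁ (x∈⁅x⁆ x))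
  ∈-fromList⁺     (there x∈)  = x∈p∪q⁺ (inj₂ (∈-fromList⁺ x∈))

  ∈-fromList⁻ : ∀ {x} xs → x ∈ fromList xs → x ∈ₗ xs
  ∈-fromList⁻ []       x∈ = ⊥-elim (∉⊥ x∈)
  ∈-fromList⁻ (y ∷ xs) x∈ with x∈p∪q⁻ ⁅ y ⁆ (fromList xs) x∈
  ... | inj₁ x∈y  = here (x∈⁅y⁆⇒x≡y y x∈y)
  ... | inj₂ x∈xs = there (∈-fromList⁻ xs x∈xs)

  length≤∣p∣ : ∀ {p : Subset n} {xs} → Unique xs → All (_∈ p) xs → length xs ≤ ∣ p ∣
  length≤∣p∣ []         []          = z≤n
  length≤∣p∣ (x∉ ∷ xs!) (x∈ ∷ xs⊆) =
    ≤-trans (s≤s (length≤∣p∣ xs! (All.zipWith (λ (y∈ , x≢y) → x∈p∧x≢y⇒x∈p-y y∈ (≢-sym x≢y)) (xs⊆ , x∉))))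
            (x∈p⇒∣p-x∣<∣p∣ x∈)

∣⁅x⁆∪p∣≡1+∣p∣ : ∀ {n} (x : Fin n) (p : Subset n) → x ∉ p → ∣ ⁅ x ⁆ ∪ p ∣ ≡ suc ∣ p ∣
∣⁅x⁆∪p∣≡1+∣p∣ zero    (outside Vec.∷ p) x∉ = cong (λ q → suc ∣ q ∣) (∪-identityˡ p)
∣⁅x⁆∪p∣≡1+∣p∣ zero    (inside  Vec.∷ p) x∉ = ⊥-elim (x∉ Vec.here)
∣⁅x⁆∪p∣≡1+∣p∣ (suc x) (outside Vec.∷ p) x∉ = ∣⁅x⁆∪p∣≡1+∣p∣ x p (x∉ ∘ Vec.there)
∣⁅x⁆∪p∣≡1+∣p∣ (suc x) (inside  Vec.∷ p) x∉ = cong suc (∣⁅x⁆∪p∣≡1+∣p∣ x p (x∉ ∘ Vec.there))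

∣fromList∣≡length : ∀ {n} {xs : List (Fin n)} → Unique xs → ∣ fromList xs ∣ ≡ length xs
∣fromList∣≡length {n} {xs = []}     []           = ∣⊥∣≡0 n
∣fromList∣≡length     {xs = x ∷ xs} (x∉xs ∷ xs!) =
  trans (∣⁅x⁆∪p∣≡1+∣p∣ x (fromList xs) (λ x∈ → All.lookup x∉xs (∈-fromList⁻ xs x∈) refl))
        (cong suc (∣fromList∣≡length xs!))

unique-map : ∀ {A B : Set} {f : A → B} {xs : List A} → Unique xs →
             (∀ {x y} → x ∈ₗ xs → y ∈ₗ xs → f x ≡ f y → x ≡ y) → Unique (map f xs)
unique-map {xs = []}     []          f-inj = []
unique-map {f = f} {xs = x ∷ xs} (x∉xs ∷ xs!) f-inj =
  All.tabulate fx∉ ∷ unique-map xs! (λ y∈ z∈ → f-inj (there y∈) (there z∈))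
  where
  fx∉ : ∀ {y} → y ∈ₗ map f xs → f x ≢ y
  fx∉ y∈ fx≡y with ∈-map⁻ f y∈
  ... | z , z∈ , refl = All.lookup x∉xs z∈ (f-inj (here refl) (there z∈) fx≡y)

image-of-injection : ∀ {n} {xs : List (Fin n)} {U′ : Subset n} (φ : Fin n → Fin n) → Unique xs →
                     (∀ {u u′} → u ∈ₗ xs → u′ ∈ₗ xs → φ u ≡ φ u′ → u ≡ u′) →
                     (∀ {u} → u ∈ₗ xs → φ u ∈ U′) → ∣ U′ ∣ ≤ length xs →
                     IsImage (fromList xs) φ U′
image-of-injection {xs = xs} {U′} φ xs! φ-inj φ-into ∣U′∣≤ x = onto , into
  where
  into : (∃ λ u → u ∈ fromList xs × φ u ≡ x) → x ∈ U′
  into (u , u∈ , refl) = φ-into (∈-fromList⁻ xs u∈)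
  φ∈U′ : ∀ {y} → y ∈ₗ map φ xs → y ∈ U′
  φ∈U′ y∈ with ∈-map⁻ φ y∈
  ... | u , u∈ , refl = φ-into u∈
  onto : x ∈ U′ → ∃ λ u → u ∈ fromList xs × φ u ≡ x
  onto x∈ with any? (x Fin.≟_) (map φ xs)
  ... | yes x∈φxs = let u , u∈ , x≡φu = ∈-map⁻ φ x∈φxs in u , ∈-fromList⁺ u∈ , sym x≡φu
  ... | no  x∉φxs = ⊥-elim (n≮n (length xs) (subst (_≤ length xs) (cong suc (length-map φ xs)) too-many))
    where
    x∉ : All (x ≢_) (map φ xs)
    x∉ = All.tabulate λ y∈ x≡y → x∉φxs (subst (_∈ₗ map φ xs) (sym x≡y) y∈)
    too-many : suc (length (map φ xs)) ≤ length xs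
    too-many = ≤-trans (length≤∣p∣ (x∉ ∷ unique-map xs! φ-inj) (x∈ ∷ All.tabulate φ∈U′)) ∣U′∣≤

module Moves {A : Set} (_≟_ : DecidableEquality A) where

  apply : List (A × A) → A → A
  apply []             x = x
  apply ((a , b) ∷ ms) x with x ≟ a
  ... | yes _ = b
  ... | no  _ = apply ms x

  sources targets : List (A × A) → List A
  sources = map proj₁
  targets = map proj₂

  apply-cases : ∀ ms x → (x ∉ₗ sources ms × apply ms x ≡ x) ⊎ (∃ λ y → (x , y) ∈ₗ ms × apply ms x ≡ y)
  apply-cases []             x = inj₁ ((λ ()) , refl)
  apply-cases ((a , b) ∷ ms) x with x ≟ a
  ... | yes refl = inj₂ (b , here refl , refl)
  ... | no  x≢a  with apply-cases ms x
  ...   | inj₁ (x∉ , stay)      = inj₁ ((λ { (here x≡a) → x≢a x≡a ; (there x∈) → x∉ x∈ }) , stay)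
  ...   | inj₂ (y , xy∈ , move) = inj₂ (y , there xy∈ , move)

  apply-move : ∀ ms {a b} → Unique (sources ms) → (a , b) ∈ₗ ms → apply ms a ≡ b
  apply-move ((a , b) ∷ ms) _ (here refl) with a ≟ a
  ... | yes _   = refl
  ... | no  a≢a = ⊥-elim (a≢a refl)
  apply-move ((a′ , b′) ∷ ms) {a} (a′∉ ∷ ms!) (there ab∈) with a ≟ a′
  ... | yes refl = ⊥-elim (All.lookup a′∉ (∈-map⁺ proj₁ ab∈) refl)
  ... | no  _    = apply-move ms ms! ab∈

  same-target⇒same-source : ∀ ms {a a′ b} → Unique (targets ms) →
                            (a , b) ∈ₗ ms → (a′ , b) ∈ₗ ms → a ≡ a′
  same-target⇒same-source (_ ∷ ms) _         (here refl) (here refl)  = refl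
  same-target⇒same-source (_ ∷ ms) (b∉ ∷ _)  (here refl) (there a′b∈) =
    ⊥-elim (All.lookup b∉ (∈-map⁺ proj₂ a′b∈) refl)
  same-target⇒same-source (_ ∷ ms) (b∉ ∷ _)  (there ab∈) (here refl)  =
    ⊥-elim (All.lookup b∉ (∈-map⁺ proj₂ ab∈) refl)
  same-target⇒same-source (_ ∷ ms) (_ ∷ ms!) (there ab∈) (there a′b∈) = same-target⇒same-source ms ms! ab∈ a′b∈

  apply-along : ∀ {R : A → A → Set} ms → All (λ (a , b) → R a b) ms →
                ∀ x → apply ms x ≡ x ⊎ R x (apply ms x)
  apply-along ms along x with apply-cases ms x
  ... | inj₁ (_ , stay)        = inj₁ stay
  ... | inj₂ (y , xy∈ , refl) = inj₂ (All.lookup along xy∈)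

  Vacated : (A → Set) → List (A × A) → Set
  Vacated U ms = All (λ (_ , b) → ¬ U b ⊎ b ∈ₗ sources ms) ms

  occupied-target∈sources : ∀ {U} ms → Vacated U ms →
                            ∀ {a b x} → (a , b) ∈ₗ ms → U x → x ≡ b → x ∈ₗ sources ms
  occupied-target∈sources ms vacated ab∈ b∈U refl with All.lookup vacated ab∈
  ... | inj₁ b∉U = ⊥-elim (b∉U b∈U)
  ... | inj₂ b∈s = b∈s

  apply-injective : ∀ {U} ms → Unique (targets ms) → Vacated U ms →
                    ∀ {x x′} → U x → U x′ → apply ms x ≡ apply ms x′ → x ≡ x′
  apply-injective ms ts! vacated {x} {x′} x∈ x′∈ eq with apply-cases ms x | apply-cases ms x′
  ... | inj₁ (_ , stay) | inj₁ (_ , stay′) = trans (sym stay) (trans eq stay′)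
  ... | inj₁ (x∉ , stay) | inj₂ (_ , x′y′∈ , move′) =
    ⊥-elim (x∉ (occupied-target∈sources ms vacated x′y′∈ x∈ (trans (sym stay) (trans eq move′))))
  ... | inj₂ (_ , xy∈ , move) | inj₁ (x′∉ , stay′) =
    ⊥-elim (x′∉ (occupied-target∈sources ms vacated xy∈ x′∈ (trans (sym stay′) (trans (sym eq) move))))
  ... | inj₂ (_ , xy∈ , move) | inj₂ (_ , x′y′∈ , move′) =
    same-target⇒same-source ms ts! xy∈
      (subst (λ z → (x′ , z) ∈ₗ ms) (trans (sym move′) (trans (sym eq) move)) x′y′∈)

path₂ : SP
path₂ = ser edge edge

fan : ℕ → SP
fan zero    = path₂
fan (suc m) = par path₂ (fan m)

size-fan : ∀ m → size (fan m) ≡ 3 + m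
size-fan zero    = refl
size-fan (suc m) = cong (λ s → 3 + s ∸ 2) (size-fan m)

fan-edge⁺ : ∀ m (ℓ : Fin (suc m)) → (0 , 2 + toℕ ℓ) ∈ₗ edges (fan m) × (2 + toℕ ℓ , 1) ∈ₗ edges (fan m)
fan-edge⁺ zero    zero    = here refl , there (here refl)
fan-edge⁺ (suc m) zero    = here refl , there (here refl)
fan-edge⁺ (suc m) (suc ℓ) = let in₁ , in₂ = fan-edge⁺ m ℓ in shift in₁ , shift in₂
  where
  shift : ∀ {e} → e ∈ₗ edges (fan m) → Product.map (parR 3) (parR 3) e ∈ₗ edges (fan (suc m))
  shift = ∈-++⁺ʳ (edges path₂) ∘ ∈-map⁺ (Product.map (parR 3) (parR 3))

fan-edge⁻ : ∀ m {e} → e ∈ₗ edges (fan m) →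
            ∃ λ (ℓ : Fin (suc m)) → e ≡ (0 , 2 + toℕ ℓ) ⊎ e ≡ (2 + toℕ ℓ , 1)
fan-edge⁻ zero    (here refl)         = zero , inj₁ refl
fan-edge⁻ zero    (there (here refl)) = zero , inj₂ refl
fan-edge⁻ (suc m) (here refl)         = zero , inj₁ refl
fan-edge⁻ (suc m) (there (here refl)) = zero , inj₂ refl
fan-edge⁻ (suc m) (there (there e∈)) with ∈-map⁻ (Product.map (parR 3) (parR 3)) e∈
... | e′ , e′∈ , refl with fan-edge⁻ m e′∈
...   | ℓ , inj₁ refl = suc ℓ , inj₁ refl
...   | ℓ , inj₂ refl = suc ℓ , inj₂ refl

another : ∀ {q} (i : Fin (2 + q)) → ∃ λ j → j ≢ i
another zero    = suc zero , λ ()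
another (suc i) = zero , λ ()

module Gadgets (m : ℕ) where

  M : ℕ
  M = 3 + m

  gadget : SP
  gadget = ser path₂ (fan m)

  gadgets : ℕ → SP
  gadgets zero    = gadget
  gadgets (suc q) = par gadget (gadgets q)

  size-gadget : size gadget ≡ 2 + M
  size-gadget = cong (λ s → 3 + s ∸ 1) (size-fan m)

  size-gadgets : ∀ q → size (gadgets q) ≡ 2 + suc q ℕ.* M
  size-gadgets zero    = trans size-gadget (cong (_+_ 2) (sym (+-identityʳ M)))
  size-gadgets (suc q) = begin
    size gadget + size (gadgets q) ∸ 2   ≡⟨ cong₂ (λ s t → s + t ∸ 2) size-gadget (size-gadgets q) ⟩
    M + (2 + suc q ℕ.* M)                ≡⟨ +-suc M _ ⟩
    suc (M + suc (suc q ℕ.* M))          ≡⟨ cong suc (+-suc M _) ⟩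
    2 + suc (suc q) ℕ.* M                ∎
    where open ≡-Reasoning

  -- inner i o has offset o in gadget i; within gadget, offsets 0, 1 and 2 + ℓ (hub, link and
  -- leaf ℓ) carry the labels 2, 3 and 4 + ℓ.
  data Vertex (k : ℕ) : Set where
    source sink : Vertex k
    inner       : Fin k → Fin M → Vertex k

  pattern hub  i   = inner i zero
  pattern link i   = inner i (suc zero)
  pattern leaf i ℓ = inner i (suc (suc ℓ))

  inner-≢ : ∀ {k} {i j : Fin k} {o o′} → i ≢ j → inner i o ≢ inner j o′
  inner-≢ i≢j refl = i≢j refl

  inner-injective : ∀ {k} {i j : Fin k} {o o′} → inner i o ≡ inner j o′ → i ≡ j × o ≡ o′
  inner-injective refl = refl , refl

  _≟ᵥ_ : ∀ {k} → DecidableEquality (Vertex k)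
  source    ≟ᵥ source     = yes refl
  sink      ≟ᵥ sink       = yes refl
  inner i o ≟ᵥ inner j o′ =
    Dec.map′ (λ (i≡j , o≡o′) → cong₂ inner i≡j o≡o′) inner-injective (i Fin.≟ j ×-dec o Fin.≟ o′)
  source    ≟ᵥ sink       = no λ ()
  source    ≟ᵥ inner _ _  = no λ ()
  sink      ≟ᵥ source     = no λ ()
  sink      ≟ᵥ inner _ _  = no λ ()
  inner _ _ ≟ᵥ source     = no λ ()
  inner _ _ ≟ᵥ sink       = no λ ()

  data Edge {k} : Vertex k → Vertex k → Set where
    source-link : ∀ i   → Edge source (link i)
    link-hub    : ∀ i   → Edge (link i) (hub i)
    hub-leaf    : ∀ i ℓ → Edge (hub i) (leaf i ℓ)
    leaf-sink   : ∀ i ℓ → Edge (leaf i ℓ) sink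

  Adjacent : ∀ {k} → Vertex k → Vertex k → Set
  Adjacent a b = Edge a b ⊎ Edge b a

  adjacent-sym : ∀ {k} {a b : Vertex k} → Adjacent a b → Adjacent b a
  adjacent-sym (inj₁ ab) = inj₂ ab
  adjacent-sym (inj₂ ba) = inj₁ ba

  edge-irreflexive : ∀ {k} {a b : Vertex k} → Edge a b → a ≢ b
  edge-irreflexive (source-link _) ()
  edge-irreflexive (link-hub _)    ()
  edge-irreflexive (hub-leaf _ _)  ()
  edge-irreflexive (leaf-sink _ _) ()

  adjacent-irreflexive : ∀ {k} {a b : Vertex k} → Adjacent a b → a ≢ b
  adjacent-irreflexive (inj₁ ab) = edge-irreflexive ab
  adjacent-irreflexive (inj₂ ba) = edge-irreflexive ba ∘ sym

  label : ∀ {k} → Vertex k → ℕ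
  label source      = 0
  label sink        = 1
  label (inner i o) = 2 + (toℕ i ℕ.* M + toℕ o)

  lift : ∀ {k} → Vertex k → Vertex (suc k)
  lift source      = source
  lift sink        = sink
  lift (inner i o) = inner (suc i) o

  label-lift : ∀ {k} (a : Vertex k) → label (lift a) ≡ parR (size gadget) (label a)
  label-lift source      = refl
  label-lift sink        = refl
  label-lift (inner i o) = sym (begin
    size gadget + (toℕ i ℕ.* M + toℕ o)   ≡⟨ cong (_+ (toℕ i ℕ.* M + toℕ o)) size-gadget ⟩
    2 + (M + (toℕ i ℕ.* M + toℕ o))       ≡⟨ cong (_+_ 2) (+-assoc M _ _) ⟨
    2 + (M + toℕ i ℕ.* M + toℕ o)         ∎)
    where open ≡-Reasoning

  lift-edge : ∀ {k} {a b : Vertex k} → Edge a b → Edge (lift a) (lift b)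
  lift-edge (source-link i) = source-link (suc i)
  lift-edge (link-hub i)    = link-hub (suc i)
  lift-edge (hub-leaf i ℓ)  = hub-leaf (suc i) ℓ
  lift-edge (leaf-sink i ℓ) = leaf-sink (suc i) ℓ

  private
    fan-shift : ∀ {e} → e ∈ₗ edges (fan m) → Product.map (serR 3) (serR 3) e ∈ₗ edges gadget
    fan-shift = ∈-++⁺ʳ (relabel serL (edges path₂)) ∘ ∈-map⁺ (Product.map (serR 3) (serR 3))

    in-first : ∀ q {e} → e ∈ₗ edges gadget → e ∈ₗ edges (gadgets q)
    in-first zero    e∈ = e∈
    in-first (suc q) e∈ = ∈-++⁺ˡ e∈

    in-rest : ∀ q (a b : Vertex (suc q)) → (label a , label b) ∈ₗ edges (gadgets q) →
              (label (lift a) , label (lift b)) ∈ₗ edges (gadgets (suc q))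
    in-rest q a b e∈ rewrite label-lift a | label-lift b =
      ∈-++⁺ʳ (edges gadget) (∈-map⁺ (Product.map (parR (size gadget)) (parR (size gadget))) e∈)

  edge⁺ : ∀ q {a b : Vertex (suc q)} → Edge a b → (label a , label b) ∈ₗ edges (gadgets q)
  edge⁺ q       (source-link zero)    = in-first q (here refl)
  edge⁺ q       (link-hub zero)       = in-first q (there (here refl))
  edge⁺ q       (hub-leaf zero ℓ)     = in-first q (fan-shift (proj₁ (fan-edge⁺ m ℓ)))
  edge⁺ q       (leaf-sink zero ℓ)    = in-first q (fan-shift (proj₂ (fan-edge⁺ m ℓ)))
  edge⁺ (suc q) (source-link (suc i)) = in-rest q source (link i) (edge⁺ q (source-link i))
  edge⁺ (suc q) (link-hub (suc i))    = in-rest q (link i) (hub i) (edge⁺ q (link-hub i))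
  edge⁺ (suc q) (hub-leaf (suc i) ℓ)  = in-rest q (hub i) (leaf i ℓ) (edge⁺ q (hub-leaf i ℓ))
  edge⁺ (suc q) (leaf-sink (suc i) ℓ) = in-rest q (leaf i ℓ) sink (edge⁺ q (leaf-sink i ℓ))

  LabelledEdge : ∀ q → ℕ × ℕ → Set
  LabelledEdge q e = ∃₂ λ (a b : Vertex (suc q)) → Edge a b × e ≡ (label a , label b)

  private
    gadget-edge⁻ : ∀ {q e} → e ∈ₗ edges gadget → LabelledEdge q e
    gadget-edge⁻ (here refl)         = source , link zero , source-link zero , refl
    gadget-edge⁻ (there (here refl)) = link zero , hub zero , link-hub zero , refl
    gadget-edge⁻ (there (there e∈)) with ∈-map⁻ (Product.map (serR 3) (serR 3)) e∈
    ... | _ , e′∈ , refl with fan-edge⁻ m e′∈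
    ...   | ℓ , inj₁ refl = hub zero , leaf zero ℓ , hub-leaf zero ℓ , refl
    ...   | ℓ , inj₂ refl = leaf zero ℓ , sink , leaf-sink zero ℓ , refl

  edge⁻ : ∀ q {e} → e ∈ₗ edges (gadgets q) → LabelledEdge q e
  edge⁻ zero    e∈ = gadget-edge⁻ e∈
  edge⁻ (suc q) e∈ with ∈-++⁻ (edges gadget) e∈
  ... | inj₁ e∈₁ = gadget-edge⁻ e∈₁
  ... | inj₂ e∈₂ with ∈-map⁻ (Product.map (parR (size gadget)) (parR (size gadget))) e∈₂
  ...   | _ , e′∈ , refl with edge⁻ q e′∈
  ...     | a , b , ab , refl = lift a , lift b , lift-edge ab , sym (cong₂ _,_ (label-lift a) (label-lift b))

  position : ∀ {k} → Vertex k → Fin (2 + k ℕ.* M)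
  position source      = zero
  position sink        = suc zero
  position (inner i o) = suc (suc (combine i o))

  vertexAt : ∀ {k} → Fin (2 + k ℕ.* M) → Vertex k
  vertexAt zero          = source
  vertexAt (suc zero)    = sink
  vertexAt (suc (suc w)) = uncurry inner (remQuot M w)

  vertexAt-position : ∀ {k} (a : Vertex k) → vertexAt (position a) ≡ a
  vertexAt-position source      = refl
  vertexAt-position sink        = refl
  vertexAt-position (inner i o) = cong (uncurry inner) (remQuot-combine i o)

  position-vertexAt : ∀ {k} (p : Fin (2 + k ℕ.* M)) → position {k} (vertexAt p) ≡ p
  position-vertexAt         zero          = refl
  position-vertexAt         (suc zero)    = refl
  position-vertexAt {k = k} (suc (suc w)) =
    cong (λ (v : Fin (k ℕ.* M)) → suc (suc v)) (combine-remQuot {k} M w)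

  toℕ-position : ∀ {k} (a : Vertex k) → toℕ (position a) ≡ label a
  toℕ-position source      = refl
  toℕ-position sink        = refl
  toℕ-position (inner i o) = cong (_+_ 2) (trans (toℕ-combine i o) (cong (_+ toℕ o) (*-comm M (toℕ i))))

  module Encoding (q : ℕ) where

    G : Graph
    G = spGraph (gadgets q)

    V : Set
    V = Vertex (suc q)

    enc : V → Fin (n G)
    enc = cast (sym (size-gadgets q)) ∘ position

    dec : Fin (n G) → V
    dec = vertexAt ∘ cast (size-gadgets q)

    dec-enc : ∀ a → dec (enc a) ≡ a
    dec-enc a = trans (cong vertexAt (cast-involutive (size-gadgets q) _ (position a))) (vertexAt-position a)

    enc-dec : ∀ u → enc (dec u) ≡ u
    enc-dec u = trans (cong (cast (sym (size-gadgets q))) (position-vertexAt {suc q} _))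
                      (cast-involutive (sym (size-gadgets q)) (size-gadgets q) u)

    enc-injective : ∀ {a b} → enc a ≡ enc b → a ≡ b
    enc-injective {a} {b} eq = trans (sym (dec-enc a)) (trans (cong dec eq) (dec-enc b))

    dec-injective : ∀ {u v} → dec u ≡ dec v → u ≡ v
    dec-injective {u} {v} eq = trans (sym (enc-dec u)) (trans (cong enc eq) (enc-dec v))

    toℕ-enc : ∀ a → toℕ (enc a) ≡ label a
    toℕ-enc a = trans (toℕ-cast _ (position a)) (toℕ-position a)

    dec-label : ∀ {u a} → toℕ u ≡ label a → dec u ≡ a
    dec-label {u} {a} eq = trans (cong dec (toℕ-injective (trans eq (sym (toℕ-enc a))))) (dec-enc a)

    edge∈E : ∀ {a b} → Edge a b → (toℕ (enc a) , toℕ (enc b)) ∈ₗ E G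
    edge∈E {a} {b} ab = subst (_∈ₗ E G) (sym (cong₂ _,_ (toℕ-enc a) (toℕ-enc b))) (edge⁺ q ab)

    adjacent⇒adj : ∀ {a b} → Adjacent a b → Adj G (enc a) (enc b)
    adjacent⇒adj (inj₁ ab) = inj₁ (edge∈E ab)
    adjacent⇒adj (inj₂ ba) = inj₂ (edge∈E ba)

    ∈E⇒edge : ∀ {u v} → (toℕ u , toℕ v) ∈ₗ E G → Edge (dec u) (dec v)
    ∈E⇒edge uv with edge⁻ q uv
    ... | a , b , ab , eq = subst₂ Edge (sym (dec-label (cong proj₁ eq))) (sym (dec-label (cong proj₂ eq))) ab

    adj⇒adjacent : ∀ {u v} → Adj G u v → Adjacent (dec u) (dec v)
    adj⇒adjacent (inj₁ uv) = inj₁ (∈E⇒edge uv)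
    adj⇒adjacent (inj₂ vu) = inj₂ (∈E⇒edge vu)

module Biconnectivity (m q : ℕ) where
  open Gadgets m
  open Encoding (suc q)

  record Avoiding (x a b : V) : Set where
    constructor avoiding
    field walk : Reach G (λ u → u ≢ enc x) (enc a) (enc b)
  open Avoiding

  stop : ∀ {x a} → a ≢ x → Avoiding x a a
  stop a≢x = avoiding (here (a≢x ∘ enc-injective))

  infixr 5 _∷⟨_⟩_
  _∷⟨_⟩_ : ∀ {x a b c} → a ≢ x → Adjacent a b → Avoiding x b c → Avoiding x a c
  a≢x ∷⟨ ab ⟩ w = avoiding (step (a≢x ∘ enc-injective) (adjacent⇒adj ab) (walk w))

  hub→sink : ∀ {x} i → hub i ≢ x → leaf i zero ≢ x → sink ≢ x → Avoiding x (hub i) sink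
  hub→sink i h l t = h ∷⟨ inj₁ (hub-leaf i zero) ⟩ l ∷⟨ inj₁ (leaf-sink i zero) ⟩ stop t

  link→sink : ∀ {x} i → link i ≢ x → hub i ≢ x → leaf i zero ≢ x → sink ≢ x → Avoiding x (link i) sink
  link→sink i k h l t = k ∷⟨ inj₁ (link-hub i) ⟩ hub→sink i h l t

  hub→source : ∀ {x} i → hub i ≢ x → link i ≢ x → source ≢ x → Avoiding x (hub i) source
  hub→source i h k s = h ∷⟨ inj₂ (link-hub i) ⟩ k ∷⟨ inj₂ (source-link i) ⟩ stop s

  leaf→source : ∀ {x} i ℓ → leaf i ℓ ≢ x → hub i ≢ x → link i ≢ x → source ≢ x →
                Avoiding x (leaf i ℓ) source
  leaf→source i ℓ l h k s = l ∷⟨ inj₂ (hub-leaf i ℓ) ⟩ hub→source i h k s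

  pole : V → V
  pole sink       = source
  pole (leaf _ _) = source
  pole _          = sink

  to-pole : ∀ x a → a ≢ x → Avoiding x a (pole x)
  to-pole source     source     a≢x = ⊥-elim (a≢x refl)
  to-pole source     sink       _   = stop (λ ())
  to-pole source     (hub i)    _   = hub→sink i (λ ()) (λ ()) (λ ())
  to-pole source     (link i)   _   = link→sink i (λ ()) (λ ()) (λ ()) (λ ())
  to-pole source     (leaf i ℓ) _   = (λ ()) ∷⟨ inj₁ (leaf-sink i ℓ) ⟩ stop (λ ())
  to-pole sink       sink       a≢x = ⊥-elim (a≢x refl)
  to-pole sink       source     _   = stop (λ ())
  to-pole sink       (hub i)    _   = hub→source i (λ ()) (λ ()) (λ ())
  to-pole sink       (link i)   _   = (λ ()) ∷⟨ inj₂ (source-link i) ⟩ stop (λ ())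
  to-pole sink       (leaf i ℓ) _   = leaf→source i ℓ (λ ()) (λ ()) (λ ()) (λ ())
  to-pole (hub i₀)   source     _   = let j , j≢ = another i₀ in
    (λ ()) ∷⟨ inj₁ (source-link j) ⟩ link→sink j (λ ()) (inner-≢ j≢) (λ ()) (λ ())
  to-pole (hub i₀)   sink       _   = stop (λ ())
  to-pole (hub i₀)   (hub i)    a≢x = hub→sink i a≢x (λ ()) (λ ())
  to-pole (hub i₀)   (link i)   a≢x with i Fin.≟ i₀
  ... | yes refl = let j , j≢ = another i₀ in
    (λ ()) ∷⟨ inj₂ (source-link i₀) ⟩
    (λ ()) ∷⟨ inj₁ (source-link j) ⟩ link→sink j (λ ()) (inner-≢ j≢) (λ ()) (λ ())
  ... | no  i≢i₀ = link→sink i (λ ()) (inner-≢ i≢i₀) (λ ()) (λ ())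
  to-pole (hub i₀)   (leaf i ℓ) _   = (λ ()) ∷⟨ inj₁ (leaf-sink i ℓ) ⟩ stop (λ ())
  to-pole (link i₀)  source     _   = let j , j≢ = another i₀ in
    (λ ()) ∷⟨ inj₁ (source-link j) ⟩ link→sink j (inner-≢ j≢) (λ ()) (λ ()) (λ ())
  to-pole (link i₀)  sink       _   = stop (λ ())
  to-pole (link i₀)  (hub i)    _   = hub→sink i (λ ()) (λ ()) (λ ())
  to-pole (link i₀)  (link i)   a≢x = link→sink i a≢x (λ ()) (λ ()) (λ ())
  to-pole (link i₀)  (leaf i ℓ) _   = (λ ()) ∷⟨ inj₁ (leaf-sink i ℓ) ⟩ stop (λ ())
  to-pole (leaf i₀ ℓ₀) source   _   = stop (λ ())
  to-pole (leaf i₀ ℓ₀) sink     _   = let j , j≢ = another i₀ in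
    (λ ()) ∷⟨ inj₂ (leaf-sink j zero) ⟩ leaf→source j zero (inner-≢ j≢) (λ ()) (λ ()) (λ ())
  to-pole (leaf i₀ ℓ₀) (hub i)  _   = hub→source i (λ ()) (λ ()) (λ ())
  to-pole (leaf i₀ ℓ₀) (link i) _   = (λ ()) ∷⟨ inj₂ (source-link i) ⟩ stop (λ ())
  to-pole (leaf i₀ ℓ₀) (leaf i ℓ) a≢x = leaf→source i ℓ a≢x (λ ()) (λ ()) (λ ())

  to-sink : ∀ a → Reach G (λ _ → ⊤) (enc a) (enc sink)
  to-sink source      = reach-map _ (walk (to-pole (hub zero) source (λ ())))
  to-sink sink        = here tt
  to-sink (inner i o) = reach-map _ (walk (to-pole source (inner i o) (λ ())))

  biconnected : Biconnected G
  biconnected = connected , no-cut-vertex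
    where
    connected : Connected G
    connected u v = subst₂ (Reach G _) (enc-dec u) (enc-dec v)
      (reach-trans (to-sink (dec u)) (reach-sym (to-sink (dec v))))
    no-cut-vertex : ∀ x u v → u ≢ x → v ≢ x → Reach G (λ y → y ≢ x) u v
    no-cut-vertex x u v u≢x v≢x = subst (λ z → Reach G (λ y → y ≢ z) u v) (enc-dec x)
      (subst₂ (Reach G _) (enc-dec u) (enc-dec v)
        (reach-trans (walk (to-pole (dec x) (dec u) (u≢x ∘ dec-injective)))
                     (reach-sym (walk (to-pole (dec x) (dec v) (v≢x ∘ dec-injective))))))

module Guards (m q : ℕ) where
  open Gadgets m
  open Encoding q

  Q : ℕ
  Q = suc q

  guards : List V → Subset (n G)
  guards as = fromList (map enc as)

  ∈-guards⁺ : ∀ {a as} → a ∈ₗ as → enc a ∈ guards as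
  ∈-guards⁺ a∈ = ∈-fromList⁺ (∈-map⁺ enc a∈)

  ∈-guards⁻ : ∀ {u} as → u ∈ guards as → dec u ∈ₗ as
  ∈-guards⁻ as u∈ with ∈-map⁻ enc (∈-fromList⁻ (map enc as) u∈)
  ... | a , a∈ , refl = subst (_∈ₗ as) (sym (dec-enc a)) a∈

  ∣guards∣ : ∀ {as} → Unique as → ∣ guards as ∣ ≡ length as
  ∣guards∣ {as} as! = trans (∣fromList∣≡length (Unique.map⁺ enc-injective as!)) (length-map enc as)

  count-guarded : ∀ {U as} → Unique as → All (λ a → enc a ∈ U) as → length as ≤ ∣ U ∣
  count-guarded {U} {as} as! as∈ =
    subst (_≤ ∣ U ∣) (length-map enc as) (length≤∣p∣ (Unique.map⁺ enc-injective as!) (All.map⁺ as∈))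

  gadgetwise : (Fin Q → Fin M) → List V
  gadgetwise f = tabulate (λ i → inner i (f i))

  hubs links : Fin Q → Fin M
  hubs  = const zero
  links = const (suc zero)

  length-gadgetwise : ∀ f → length (gadgetwise f) ≡ Q
  length-gadgetwise f = length-tabulate (λ i → inner i (f i))

  gadgetwise-unique : ∀ f → Unique (gadgetwise f)
  gadgetwise-unique f = Unique.tabulate⁺ {f = λ i → inner i (f i)} λ { refl → refl }

  ∉-gadgetwise : ∀ {a} f → (∀ i → a ≢ inner i (f i)) → All (a ≢_) (gadgetwise f)
  ∉-gadgetwise f a≢ = All.tabulate⁺ {f = λ i → inner i (f i)} a≢

  gadgetwise-disjoint : ∀ f g → (∀ i → f i ≢ g i) → Disjoint (gadgetwise f) (gadgetwise g)
  gadgetwise-disjoint f g f≢g (a∈f , a∈g)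
    with ∈-tabulate⁻ {f = λ i → inner i (f i)} a∈f | ∈-tabulate⁻ {f = λ i → inner i (g i)} a∈g
  ... | i , refl | j , eq with inner-injective eq
  ...   | refl , fi≡gi = f≢g i fi≡gi

  gadgetwise-guarded : ∀ {U} f → (∀ i → enc (inner i (f i)) ∈ U) → All (λ a → enc a ∈ U) (gadgetwise f)
  gadgetwise-guarded f f∈ = All.tabulate⁺ {f = λ i → inner i (f i)} f∈

  module _ {U : Subset (n G)} (U-covers : IsVertexCover G U) where

    other-end : ∀ {a b} → Adjacent a b → enc a ∉ U → enc b ∈ U
    other-end ab a∉ with U-covers _ _ (adjacent⇒adj ab)
    ... | inj₁ a∈ = ⊥-elim (a∉ a∈)
    ... | inj₂ b∈ = b∈

    leaves-guarded : ∀ i → (∀ ℓ → enc (leaf i ℓ) ∈ U) → suc m ≤ ∣ U ∣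
    leaves-guarded i leaves∈ = subst (_≤ ∣ U ∣) (length-tabulate leaves)
      (count-guarded (Unique.tabulate⁺ {f = leaves} λ { refl → refl }) (All.tabulate⁺ {f = leaves} leaves∈))
      where
      leaves : Fin (suc m) → V
      leaves ℓ = leaf i ℓ

    sink-guarded : suc m ≤ ∣ U ∣ ⊎ enc sink ∈ U
    sink-guarded with enc sink ∈? U
    ... | yes t∈ = inj₂ t∈
    ... | no  t∉ = inj₁ (leaves-guarded zero λ ℓ → other-end (inj₂ (leaf-sink zero ℓ)) t∉)

    hub-guarded : ∀ i → suc m ≤ ∣ U ∣ ⊎ enc (hub i) ∈ U
    hub-guarded i with enc (hub i) ∈? U
    ... | yes h∈ = inj₂ h∈
    ... | no  h∉ = inj₁ (leaves-guarded i λ ℓ → other-end (inj₁ (hub-leaf i ℓ)) h∉)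

  guards-cover : ∀ as → (∀ {a b} → Edge a b → a ∈ₗ as ⊎ b ∈ₗ as) → IsVertexCover G (guards as)
  guards-cover as covers u v uv = Sum.map (guarded u) (guarded v) (cover-ends (adj⇒adjacent uv))
    where
    guarded : ∀ w → dec w ∈ₗ as → w ∈ guards as
    guarded w a∈ = subst (_∈ guards as) (enc-dec w) (∈-guards⁺ a∈)
    cover-ends : Adjacent (dec u) (dec v) → dec u ∈ₗ as ⊎ dec v ∈ₗ as
    cover-ends (inj₁ e) = covers e
    cover-ends (inj₂ e) = Sum.swap (covers e)

  2+Q≤∣U∣ : ∀ {U} a b f → a ≢ b → All (a ≢_) (gadgetwise f) → All (b ≢_) (gadgetwise f) →
            enc a ∈ U → enc b ∈ U → (∀ i → enc (inner i (f i)) ∈ U) → 2 + Q ≤ ∣ U ∣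
  2+Q≤∣U∣ {U} a b f a≢b a∉ b∉ a∈ b∈ f∈ =
    subst (λ l → 2 + l ≤ ∣ U ∣) (length-gadgetwise f)
      (count-guarded ((a≢b ∷ a∉) ∷ b∉ ∷ gadgetwise-unique f) (a∈ ∷ b∈ ∷ gadgetwise-guarded f f∈))

  2+[Q+Q]≤∣U∣ : ∀ {U} f → (∀ i → f i ≢ zero) → enc source ∈ U → enc sink ∈ U →
                (∀ i → enc (hub i) ∈ U) → (∀ i → enc (inner i (f i)) ∈ U) → 2 + (Q + Q) ≤ ∣ U ∣
  2+[Q+Q]≤∣U∣ {U} f f≢0 s∈ t∈ hubs∈ f∈ = subst (λ l → 2 + l ≤ ∣ U ∣) length≡
    (count-guarded (((λ ()) ∷ pole∉ source λ ()) ∷ pole∉ sink (λ ()) ∷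
                    Unique.++⁺ (gadgetwise-unique hubs) (gadgetwise-unique f)
                               (gadgetwise-disjoint hubs f (≢-sym ∘ f≢0)))
                   (s∈ ∷ t∈ ∷ All.++⁺ (gadgetwise-guarded hubs hubs∈) (gadgetwise-guarded f f∈)))
    where
    pole∉ : ∀ p → (∀ {i o} → p ≢ inner i o) → All (p ≢_) (gadgetwise hubs ++ gadgetwise f)
    pole∉ p p≢ = All.++⁺ (∉-gadgetwise hubs λ _ → p≢) (∉-gadgetwise f λ _ → p≢)
    length≡ : length (gadgetwise hubs ++ gadgetwise f) ≡ Q + Q
    length≡ = trans (length-++ (gadgetwise hubs)) (cong₂ _+_ (length-gadgetwise hubs) (length-gadgetwise f))

module VertexCoverNumber (m q : ℕ) where
  open Gadgets m
  open Encoding q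
  open Guards m q

  poles-and-hubs : List V
  poles-and-hubs = source ∷ sink ∷ gadgetwise hubs

  poles-and-hubs-unique : Unique poles-and-hubs
  poles-and-hubs-unique =
    ((λ ()) ∷ ∉-gadgetwise hubs (λ _ ())) ∷ ∉-gadgetwise hubs (λ _ ()) ∷ gadgetwise-unique hubs

  poles-and-hubs-cover : IsVertexCover G (guards poles-and-hubs)
  poles-and-hubs-cover = guards-cover poles-and-hubs λ where
    (source-link i) → inj₁ (here refl)
    (link-hub i)    → inj₂ (there (there (∈-tabulate⁺ {f = λ j → hub j} i)))
    (hub-leaf i ℓ)  → inj₁ (there (there (∈-tabulate⁺ {f = λ j → hub j} i)))
    (leaf-sink i ℓ) → inj₂ (there (here refl))

  vc-lower : 2 + Q ≤ suc m → ∀ U → IsVertexCover G U → 2 + Q ≤ ∣ U ∣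
  vc-lower 2+Q≤ U U-covers with sink-guarded U-covers | enc source ∈? U
  ... | inj₁ many | _      = ≤-trans 2+Q≤ many
  ... | inj₂ t∈   | yes s∈ =
    2+Q≤∣U∣ source sink w (λ ()) (∉-gadgetwise w (λ _ ())) (∉-gadgetwise w (λ _ ()))
      s∈ t∈ (proj₂ ∘ link-or-hub)
    where
    link-or-hub : ∀ i → ∃ λ o → enc (inner i o) ∈ U
    link-or-hub i with enc (hub i) ∈? U
    ... | yes h∈ = zero , h∈
    ... | no  h∉ = suc zero , other-end U-covers (inj₂ (link-hub i)) h∉
    w : Fin Q → Fin M
    w = proj₁ ∘ link-or-hub
  ... | inj₂ t∈   | no  s∉ =
    2+Q≤∣U∣ sink (inner zero (proj₁ hub-or-leaf)) links (λ ()) (∉-gadgetwise links (λ _ ()))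
      (∉-gadgetwise links λ i eq → proj₁ (proj₂ hub-or-leaf) (proj₂ (inner-injective eq)))
      t∈ (proj₂ (proj₂ hub-or-leaf)) (λ i → other-end U-covers (inj₁ (source-link i)) s∉)
    where
    hub-or-leaf : ∃ λ o → o ≢ suc zero × enc (inner zero o) ∈ U
    hub-or-leaf with enc (hub zero) ∈? U
    ... | yes h∈ = zero , (λ ()) , h∈
    ... | no  h∉ = suc (suc zero) , (λ ()) , other-end U-covers (inj₁ (hub-leaf zero zero)) h∉

  vc-number : 2 + Q ≤ suc m → IsVCNumber G (2 + Q)
  vc-number 2+Q≤ =
    (guards poles-and-hubs , poles-and-hubs-cover ,
     trans (∣guards∣ poles-and-hubs-unique) (cong (_+_ 2) (length-gadgetwise hubs))) ,
    vc-lower 2+Q≤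

module EternalLowerBound (m q : ℕ) where
  open Gadgets m
  open Encoding q
  open Guards m q

  hub-neighbour : ∀ {a : V} {i} → Adjacent a (hub i) → ∃ λ o → o ≢ zero × a ≡ inner i o
  hub-neighbour (inj₁ (link-hub i))   = suc zero , (λ ()) , refl
  hub-neighbour (inj₂ (hub-leaf i ℓ)) = suc (suc ℓ) , (λ ()) , refl

  preimage : ∀ {U U′ φ} → (∀ u → u ∈ U → InN G u (φ u)) → IsImage U φ U′ → ∀ b → enc b ∈ U′ →
             ∃ λ a → enc a ∈ U × φ (enc a) ≡ enc b × (a ≡ b ⊎ Adjacent a b)
  preimage {U} {φ = φ} into-N img b b∈ with proj₁ (img (enc b)) b∈
  ... | u , u∈ , φu≡b =
    dec u , subst (_∈ U) (sym (enc-dec u)) u∈ , trans (cong φ (enc-dec u)) φu≡b , moved (into-N u u∈)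
    where
    moved : InN G u (φ u) → dec u ≡ b ⊎ Adjacent (dec u) b
    moved (inj₁ φu≡u) = inj₁ (trans (cong dec (trans (sym φu≡u) φu≡b)) (dec-enc b))
    moved (inj₂ uφu)  = inj₂ (subst (Adjacent (dec u)) (dec-enc b) (adj⇒adjacent (subst (Adj G u) φu≡b uφu)))

  module _ {k 𝒰} (class : IsEVCClass G k 𝒰) (k<m : k < suc m) (k<2Q : k < 2 + (Q + Q)) where

    private
      covers : ∀ {U} → 𝒰 U → IsVertexCover G U
      covers U∈ = proj₁ (proj₁ (proj₂ class) _ U∈)

      ∣U∣≡k : ∀ {U} → 𝒰 U → ∣ U ∣ ≡ k
      ∣U∣≡k U∈ = proj₂ (proj₁ (proj₂ class) _ U∈)

      defend : ∀ {U} → 𝒰 U → ∀ {a b} → Adjacent a b →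
               ∃ λ φ → Defense G U (enc a) (enc b) φ × ∃ λ U′ → 𝒰 U′ × IsImage U φ U′
      defend U∈ ab = proj₂ (proj₂ class) _ U∈ _ _ (adjacent⇒adj ab)

      not-all-leaves : ∀ {U} → 𝒰 U → ¬ (suc m ≤ ∣ U ∣)
      not-all-leaves U∈ m≤ = <⇒≱ k<m (subst (suc m ≤_) (∣U∣≡k U∈) m≤)

    guarded-sink : ∀ {U} → 𝒰 U → enc sink ∈ U
    guarded-sink U∈ with sink-guarded (covers U∈)
    ... | inj₁ many = ⊥-elim (not-all-leaves U∈ many)
    ... | inj₂ t∈   = t∈

    guarded-hub : ∀ {U} → 𝒰 U → ∀ i → enc (hub i) ∈ U
    guarded-hub U∈ i with hub-guarded (covers U∈) i
    ... | inj₁ many = ⊥-elim (not-all-leaves U∈ many)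
    ... | inj₂ h∈   = h∈

    free-leaf : ∀ {U} → 𝒰 U → ∀ i → ∃ λ ℓ → enc (leaf i ℓ) ∉ U
    free-leaf {U} U∈ i = ¬∀⟶∃¬ (suc m) (λ ℓ → enc (leaf i ℓ) ∈ U) (λ ℓ → enc (leaf i ℓ) ∈? U)
                                (not-all-leaves U∈ ∘ leaves-guarded (covers U∈) i)

    -- Attacking a free leaf of gadget i pulls the hub guard onto it; whoever refills the hub
    -- is a guarded neighbour of it.
    guarded-beside-hub : ∀ {U} → 𝒰 U → ∀ i → ∃ λ o → o ≢ zero × enc (inner i o) ∈ U
    guarded-beside-hub U∈ i with free-leaf U∈ i
    ... | ℓ , ℓ∉ with defend U∈ (inj₁ (hub-leaf i ℓ))
    ... | _ , (_ , _ , inj₂ (ℓ∈ , _)) , _ = ⊥-elim (ℓ∉ ℓ∈)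
    ... | _ , (into-N , _ , inj₁ (_ , φh≡ℓ)) , _ , U′∈ , img
        with preimage into-N img (hub i) (guarded-hub U′∈ i)
    ...   | a , a∈ , φa≡h , inj₁ refl =
            ⊥-elim (0≢1+n (proj₂ (inner-injective (enc-injective {hub i} {leaf i ℓ} (trans (sym φa≡h) φh≡ℓ)))))
    ...   | a , a∈ , φa≡h , inj₂ ah with hub-neighbour ah
    ...     | o , o≢0 , refl = o , o≢0 , a∈

    unguarded-source : ∀ {U} → 𝒰 U → enc source ∉ U
    unguarded-source {U} U∈ s∈ = <⇒≱ k<2Q (subst (2 + (Q + Q) ≤_) (∣U∣≡k U∈)
      (2+[Q+Q]≤∣U∣ (proj₁ ∘ beside) (proj₁ ∘ proj₂ ∘ beside) s∈ (guarded-sink U∈) (guarded-hub U∈)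
                   (proj₂ ∘ proj₂ ∘ beside)))
      where
      beside : ∀ i → ∃ λ o → o ≢ zero × enc (inner i o) ∈ U
      beside = guarded-beside-hub U∈

    no-small-class : ⊥
    no-small-class with proj₁ class
    ... | U , U∈ with defend U∈ (inj₁ (source-link zero))
    ...   | _ , (_ , _ , inj₁ (s∈ , _)) , _ = unguarded-source U∈ s∈
    ...   | _ , (_ , _ , inj₂ (l∈ , φl≡s)) , _ , U′∈ , img =
            unguarded-source U′∈ (proj₂ (img (enc source)) (enc (link zero) , l∈ , φl≡s))

  evc-lower : 2 + (Q + Q) ≤ suc m → ∀ k 𝒰 → IsEVCClass G k 𝒰 → 2 + (Q + Q) ≤ k
  evc-lower 2+2Q≤ k 𝒰 class with 2 + (Q + Q) ≤? k
  ... | yes ok = ok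
  ... | no  small = ⊥-elim (no-small-class class (≤-trans (≰⇒> small) 2+2Q≤) (≰⇒> small))

module EternalClass (m q : ℕ) where
  open Gadgets m
  open Encoding (suc q)
  open Guards m (suc q)
  open Moves (_≟ᵥ_ {Q})

  data Config : Set where
    atLinks atSource : Fin Q → Fin (suc m) → Config

  guardedLeaf : Config → V
  guardedLeaf (atLinks  i ℓ) = leaf i ℓ
  guardedLeaf (atSource i ℓ) = leaf i ℓ

  Guarded : Config → V → Set
  Guarded _              sink        = ⊤
  Guarded _              (hub _)     = ⊤
  Guarded c              (leaf b ℓ′) = leaf b ℓ′ ≡ guardedLeaf c
  Guarded (atLinks _ _)  source      = ⊥
  Guarded (atSource _ _) source      = ⊤
  Guarded (atLinks _ _)  (link _)    = ⊤
  Guarded (atSource i _) (link b)    = b ≢ i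

  linkGuard : Config → Fin Q → V
  linkGuard (atLinks _ _)  b = link b
  linkGuard (atSource i _) b with b Fin.≟ i
  ... | yes _ = source
  ... | no  _ = link b

  members : Config → List V
  members c = sink ∷ guardedLeaf c ∷ gadgetwise hubs ++ tabulate (linkGuard c)

  linkGuard-guarded : ∀ c b → Guarded c (linkGuard c b)
  linkGuard-guarded (atLinks _ _)  b = tt
  linkGuard-guarded (atSource i _) b with b Fin.≟ i
  ... | yes _   = tt
  ... | no  b≢i = b≢i

  linkGuard-link : ∀ c {b} → Guarded c (link b) → linkGuard c b ≡ link b
  linkGuard-link (atLinks _ _)  _   = refl
  linkGuard-link (atSource i _) {b} b≢i with b Fin.≟ i
  ... | yes b≡i = ⊥-elim (b≢i b≡i)
  ... | no  _   = refl

  linkGuard-source : ∀ i ℓ → linkGuard (atSource i ℓ) i ≡ source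
  linkGuard-source i ℓ with i Fin.≟ i
  ... | yes _   = refl
  ... | no  i≢i = ⊥-elim (i≢i refl)

  linkGuard-injective : ∀ c {b b′} → linkGuard c b ≡ linkGuard c b′ → b ≡ b′
  linkGuard-injective (atLinks _ _)  refl = refl
  linkGuard-injective (atSource i _) {b} {b′} eq with b Fin.≟ i | b′ Fin.≟ i
  ... | yes b≡i | yes b′≡i = trans b≡i (sym b′≡i)
  ... | no  _   | no  _    = proj₁ (inner-injective eq)
  ... | yes _   | no  _    with () ← eq
  ... | no  _   | yes _    with () ← eq

  linkGuard-not-inner : ∀ c b {i o} → o ≢ suc zero → linkGuard c b ≢ inner i o
  linkGuard-not-inner (atLinks _ _)  b o≢1 eq = o≢1 (sym (proj₂ (inner-injective eq)))
  linkGuard-not-inner (atSource i _) b o≢1 eq with b Fin.≟ i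
  ... | yes _ with () ← eq
  ... | no  _ = o≢1 (sym (proj₂ (inner-injective eq)))

  linkGuard-not-sink : ∀ c b → linkGuard c b ≢ sink
  linkGuard-not-sink (atLinks _ _)  b ()
  linkGuard-not-sink (atSource i _) b eq with b Fin.≟ i
  ... | yes _ with () ← eq
  ... | no  _ with () ← eq

  linkGuard∈ : ∀ c {b a} → linkGuard c b ≡ a → a ∈ₗ tabulate (linkGuard c)
  linkGuard∈ c {b} refl = ∈-tabulate⁺ {f = linkGuard c} b

  guarded⇒member : ∀ c {a} → Guarded c a → a ∈ₗ members c
  guarded⇒member c {sink}       _     = here refl
  guarded⇒member c {leaf b ℓ′}  eq    = there (here eq)
  guarded⇒member c {hub b}      _     = there (there (∈-++⁺ˡ (∈-tabulate⁺ {f = λ i → hub i} b)))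
  guarded⇒member c {link b}     b∈    = there (there (∈-++⁺ʳ (gadgetwise hubs) (linkGuard∈ c (linkGuard-link c b∈))))
  guarded⇒member (atSource i ℓ) {source} _ =
    there (there (∈-++⁺ʳ (gadgetwise hubs) (linkGuard∈ (atSource i ℓ) (linkGuard-source i ℓ))))

  member⇒guarded : ∀ c {a} → a ∈ₗ members c → Guarded c a
  member⇒guarded c (here refl)         = tt
  member⇒guarded c (there (here refl)) with c
  ... | atLinks  _ _ = refl
  ... | atSource _ _ = refl
  member⇒guarded c (there (there a∈)) with ∈-++⁻ (gadgetwise hubs) a∈
  ... | inj₁ a∈hubs with ∈-tabulate⁻ {f = λ i → hub i} a∈hubs
  ...   | _ , refl = tt
  member⇒guarded c (there (there a∈)) | inj₂ a∈links with ∈-tabulate⁻ {f = linkGuard c} a∈links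
  ...   | b , refl = linkGuard-guarded c b

  members-unique : ∀ c → Unique (members c)
  members-unique c =
    ((sink≢leaf c ∷ All.++⁺ (∉-gadgetwise hubs λ _ ()) (All.tabulate⁺ (λ b → linkGuard-not-sink c b ∘ sym)))) ∷
    (All.++⁺ (∉-gadgetwise hubs λ _ → leaf≢hub c) (All.tabulate⁺ (leaf≢linkGuard c))) ∷
    Unique.++⁺ (gadgetwise-unique hubs) (Unique.tabulate⁺ (linkGuard-injective c)) hubs∩links≡∅
    where
    sink≢leaf : ∀ c → sink ≢ guardedLeaf c
    sink≢leaf (atLinks _ _)  ()
    sink≢leaf (atSource _ _) ()
    leaf≢hub : ∀ c {i} → guardedLeaf c ≢ hub i
    leaf≢hub (atLinks _ _)  ()
    leaf≢hub (atSource _ _) ()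
    leaf≢linkGuard : ∀ c b → guardedLeaf c ≢ linkGuard c b
    leaf≢linkGuard c@(atLinks _ _)  b eq = linkGuard-not-inner c b (λ ()) (sym eq)
    leaf≢linkGuard c@(atSource _ _) b eq = linkGuard-not-inner c b (λ ()) (sym eq)
    hubs∩links≡∅ : ∀ {a} → ¬ (a ∈ₗ gadgetwise hubs × a ∈ₗ tabulate (linkGuard c))
    hubs∩links≡∅ (a∈hubs , a∈links)
      with ∈-tabulate⁻ {f = λ i → hub i} a∈hubs | ∈-tabulate⁻ {f = linkGuard c} a∈links
    ... | _ , refl | b , eq = linkGuard-not-inner c b (λ ()) (sym eq)

  length-members : ∀ c → length (members c) ≡ 2 + (Q + Q)
  length-members c = cong (_+_ 2) (trans (length-++ (gadgetwise hubs))
                                        (cong₂ _+_ (length-gadgetwise hubs) (length-tabulate (linkGuard c))))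

  covered : ∀ c {a b} → Edge a b → Guarded c a ⊎ Guarded c b
  covered (atLinks _ _)  (source-link _) = inj₂ tt
  covered (atSource _ _) (source-link _) = inj₁ tt
  covered _              (link-hub _)    = inj₂ tt
  covered _              (hub-leaf _ _)  = inj₁ tt
  covered _              (leaf-sink _ _) = inj₂ tt

  cover : Config → Subset (n G)
  cover c = guards (members c)

  ∈-cover⁺ : ∀ c {a} → Guarded c a → enc a ∈ cover c
  ∈-cover⁺ c a∈ = ∈-guards⁺ (guarded⇒member c a∈)

  ∈-cover⁻ : ∀ c {u} → u ∈ cover c → Guarded c (dec u)
  ∈-cover⁻ c u∈ = member⇒guarded c (∈-guards⁻ (members c) u∈)

  ∣cover∣ : ∀ c → ∣ cover c ∣ ≡ 2 + (Q + Q)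
  ∣cover∣ c = trans (∣guards∣ (members-unique c)) (length-members c)

  cover-covers : ∀ c → IsVertexCover G (cover c)
  cover-covers c = guards-cover (members c) λ ab →
    Sum.map (guarded⇒member c) (guarded⇒member c) (covered c ab)

  record Defended (c : Config) (a b : V) : Set where
    constructor defended
    field
      φ       : Fin (n G) → Fin (n G)
      defense : Defense G (cover c) (enc a) (enc b) φ
      next    : Config
      image   : IsImage (cover c) φ (cover next)

  defended-sym : ∀ {c a b} → Defended c a b → Defended c b a
  defended-sym (defended φ (into-N , injective , moved) c′ image) =
    defended φ (into-N , injective , Sum.swap moved) c′ image

  ValidMove : Config → Config → List (V × V) → V × V → Set
  ValidMove c c′ ms (x , y) = Guarded c x × Adjacent x y × (¬ Guarded c y ⊎ y ∈ₗ sources ms) × Guarded c′ y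

  defend-by-moves : ∀ c c′ ms {a b} → (a , b) ∈ₗ ms → Unique (sources ms) → Unique (targets ms) →
                    All (ValidMove c c′ ms) ms → (∀ {x} → Guarded c x → x ∉ₗ sources ms → Guarded c′ x) →
                    Defended c a b
  defend-by-moves c c′ ms {a} {b} ab∈ sources! targets! valid stay =
    defended φ (into-N , φ-injective , inj₁ (∈-cover⁺ c (proj₁ (All.lookup valid ab∈)) , φ-moves)) c′ image
    where
    φ : Fin (n G) → Fin (n G)
    φ = enc ∘ apply ms ∘ dec

    into-N : ∀ u → u ∈ cover c → InN G u (φ u)
    into-N u _ with apply-along ms (All.map (proj₁ ∘ proj₂) valid) (dec u)
    ... | inj₁ stays = inj₁ (trans (cong enc stays) (enc-dec u))
    ... | inj₂ adj   = inj₂ (subst (λ v → Adj G v (φ u)) (enc-dec u) (adjacent⇒adj adj))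

    φ-injective : ∀ u u′ → u ∈ cover c → u′ ∈ cover c → φ u ≡ φ u′ → u ≡ u′
    φ-injective u u′ u∈ u′∈ eq = dec-injective (apply-injective ms targets! (All.map (proj₁ ∘ proj₂ ∘ proj₂) valid)
                                                                (∈-cover⁻ c u∈) (∈-cover⁻ c u′∈) (enc-injective eq))

    φ-moves : φ (enc a) ≡ enc b
    φ-moves = cong enc (trans (cong (apply ms) (dec-enc a)) (apply-move ms sources! ab∈))

    next-guarded : ∀ {x} → Guarded c x → Guarded c′ (apply ms x)
    next-guarded {x} x∈ with apply-cases ms x
    ... | inj₁ (x∉ , stays)     = subst (Guarded c′) (sym stays) (stay x∈ x∉)
    ... | inj₂ (_ , xy∈ , refl) = proj₂ (proj₂ (proj₂ (All.lookup valid xy∈)))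

    image : IsImage (cover c) φ (cover c′)
    image = image-of-injection φ (Unique.map⁺ enc-injective (members-unique c))
      (λ u∈ u′∈ → φ-injective _ _ (∈-fromList⁺ u∈) (∈-fromList⁺ u′∈))
      (λ u∈ → ∈-cover⁺ c′ (next-guarded (∈-cover⁻ c (∈-fromList⁺ u∈))))
      (≤-reflexive (trans (∣cover∣ c′) (sym (trans (length-map enc (members c)) (length-members c)))))

  swap : ∀ c {a b} → Guarded c a → Guarded c b → Adjacent a b → Defended c a b
  swap c {a} {b} a∈ b∈ ab = defend-by-moves c c ((a , b) ∷ (b , a) ∷ []) (here refl)
    ((a≢b ∷ []) ∷ [] ∷ []) ((a≢b ∘ sym ∷ []) ∷ [] ∷ [])
    ((a∈ , ab , inj₂ (there (here refl)) , b∈) ∷ (b∈ , adjacent-sym ab , inj₂ (here refl) , a∈) ∷ [])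
    (λ x∈ _ → x∈)
    where
    a≢b : a ≢ b
    a≢b = adjacent-irreflexive ab

  link-unguarded : ∀ i ℓ → ¬ Guarded (atSource i ℓ) (link i)
  link-unguarded i ℓ i≢i = i≢i refl

  defend-atLinks-source-link : ∀ i ℓ b → Defended (atLinks i ℓ) source (link b)
  defend-atLinks-source-link i ℓ b with b Fin.≟ i
  ... | yes refl = defended-sym (defend-by-moves (atLinks i ℓ) (atSource i ℓ) ((link i , source) ∷ [])
      (here refl) ([] ∷ []) ([] ∷ [])
      ((tt , inj₂ (source-link i) , inj₁ (λ ()) , tt) ∷ [])
      stay)
    where
    stay : ∀ {x} → Guarded (atLinks i ℓ) x → x ∉ₗ (link i ∷ []) → Guarded (atSource i ℓ) x
    stay {sink}       _  _  = tt
    stay {hub _}      _  _  = tt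
    stay {leaf _ _}   eq _  = eq
    stay {link _}     _  x∉ = x∉ ∘ here ∘ cong link
  ... | no b≢i = defended-sym (defend-by-moves (atLinks i ℓ) (atSource b zero)
      ((link b , source) ∷ (leaf i ℓ , sink) ∷ (sink , leaf b zero) ∷ [])
      (here refl)
      (((λ ()) ∷ (λ ()) ∷ []) ∷ ((λ ()) ∷ []) ∷ [] ∷ [])
      (((λ ()) ∷ (λ ()) ∷ []) ∷ ((λ ()) ∷ []) ∷ [] ∷ [])
      ((tt   , inj₂ (source-link b)    , inj₁ (λ ())                      , tt) ∷
       (refl , inj₁ (leaf-sink i ℓ)    , inj₂ (there (there (here refl))) , tt) ∷
       (tt   , inj₂ (leaf-sink b zero) , inj₁ (inner-≢ b≢i)              , refl) ∷ [])
      stay)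
    where
    stay : ∀ {x} → Guarded (atLinks i ℓ) x → x ∉ₗ (link b ∷ leaf i ℓ ∷ sink ∷ []) →
           Guarded (atSource b zero) x
    stay {sink}       _  _  = tt
    stay {hub _}      _  _  = tt
    stay {leaf _ _}   eq x∉ = ⊥-elim (x∉ (there (here eq)))
    stay {link _}     _  x∉ = x∉ ∘ here ∘ cong link

  defend-atLinks-other-leaf : ∀ i ℓ ℓ′ → leaf i ℓ′ ≢ leaf i ℓ → Defended (atLinks i ℓ) (hub i) (leaf i ℓ′)
  defend-atLinks-other-leaf i ℓ ℓ′ new = defend-by-moves (atLinks i ℓ) (atLinks i ℓ′)
      ((hub i , leaf i ℓ′) ∷ (leaf i ℓ , hub i) ∷ [])
      (here refl)
      (((λ ()) ∷ []) ∷ [] ∷ [])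
      (((λ ()) ∷ []) ∷ [] ∷ [])
      ((tt   , inj₁ (hub-leaf i ℓ′) , inj₁ new          , refl) ∷
       (refl , inj₂ (hub-leaf i ℓ)  , inj₂ (here refl)  , tt) ∷ [])
      stay
    where
    stay : ∀ {x} → Guarded (atLinks i ℓ) x → x ∉ₗ (hub i ∷ leaf i ℓ ∷ []) → Guarded (atLinks i ℓ′) x
    stay {sink}     _  _  = tt
    stay {hub _}    _  _  = tt
    stay {leaf _ _} eq x∉ = ⊥-elim (x∉ (there (here eq)))
    stay {link _}   _  _  = tt

  defend-atLinks-other-gadget : ∀ i ℓ b ℓ′ → b ≢ i → Defended (atLinks i ℓ) (hub b) (leaf b ℓ′)
  defend-atLinks-other-gadget i ℓ b ℓ′ b≢i = defend-by-moves (atLinks i ℓ) (atSource b ℓ′)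
      ((hub b , leaf b ℓ′) ∷ (link b , hub b) ∷ (link i , source) ∷ (hub i , link i) ∷ (leaf i ℓ , hub i) ∷ [])
      (here refl)
      (((λ ()) ∷ (λ ()) ∷ inner-≢ b≢i ∷ (λ ()) ∷ []) ∷ (inner-≢ b≢i ∷ (λ ()) ∷ (λ ()) ∷ []) ∷
       ((λ ()) ∷ (λ ()) ∷ []) ∷ ((λ ()) ∷ []) ∷ [] ∷ [])
      (((λ ()) ∷ (λ ()) ∷ (λ ()) ∷ (λ ()) ∷ []) ∷ ((λ ()) ∷ (λ ()) ∷ inner-≢ b≢i ∷ []) ∷
       ((λ ()) ∷ (λ ()) ∷ []) ∷ ((λ ()) ∷ []) ∷ [] ∷ [])
      ((tt   , inj₁ (hub-leaf b ℓ′) , inj₁ (inner-≢ b≢i)                      , refl) ∷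
       (tt   , inj₁ (link-hub b)    , inj₂ (here refl)                         , tt) ∷
       (tt   , inj₂ (source-link i) , inj₁ (λ ())                              , tt) ∷
       (tt   , inj₂ (link-hub i)    , inj₂ (there (there (here refl)))         , b≢i ∘ sym) ∷
       (refl , inj₂ (hub-leaf i ℓ)  , inj₂ (there (there (there (here refl)))) , tt) ∷ [])
      stay
    where
    stay : ∀ {x} → Guarded (atLinks i ℓ) x → x ∉ₗ (hub b ∷ link b ∷ link i ∷ hub i ∷ leaf i ℓ ∷ []) →
           Guarded (atSource b ℓ′) x
    stay {sink}     _  _  = tt
    stay {hub _}    _  _  = tt
    stay {leaf _ _} eq x∉ = ⊥-elim (x∉ (there (there (there (there (here eq))))))
    stay {link _}   _  x∉ = x∉ ∘ there ∘ here ∘ cong link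

  defend-atLinks-hub-leaf : ∀ i ℓ b ℓ′ → Defended (atLinks i ℓ) (hub b) (leaf b ℓ′)
  defend-atLinks-hub-leaf i ℓ b ℓ′ with leaf b ℓ′ ≟ᵥ leaf i ℓ | b Fin.≟ i
  ... | yes eq | _        = swap (atLinks i ℓ) tt eq (inj₁ (hub-leaf b ℓ′))
  ... | no new | yes refl = defend-atLinks-other-leaf i ℓ ℓ′ new
  ... | no _   | no b≢i   = defend-atLinks-other-gadget i ℓ b ℓ′ b≢i

  defend-atLinks-leaf-sink : ∀ i ℓ b ℓ′ → Defended (atLinks i ℓ) (leaf b ℓ′) sink
  defend-atLinks-leaf-sink i ℓ b ℓ′ with leaf b ℓ′ ≟ᵥ leaf i ℓ
  ... | yes eq = swap (atLinks i ℓ) eq tt (inj₁ (leaf-sink b ℓ′))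
  ... | no new = defended-sym (defend-by-moves (atLinks i ℓ) (atLinks b ℓ′)
      ((sink , leaf b ℓ′) ∷ (leaf i ℓ , sink) ∷ [])
      (here refl)
      (((λ ()) ∷ []) ∷ [] ∷ [])
      (((λ ()) ∷ []) ∷ [] ∷ [])
      ((tt   , inj₂ (leaf-sink b ℓ′) , inj₁ new         , refl) ∷
       (refl , inj₁ (leaf-sink i ℓ)  , inj₂ (here refl) , tt) ∷ [])
      stay)
    where
    stay : ∀ {x} → Guarded (atLinks i ℓ) x → x ∉ₗ (sink ∷ leaf i ℓ ∷ []) → Guarded (atLinks b ℓ′) x
    stay {sink}     _  _  = tt
    stay {hub _}    _  _  = tt
    stay {leaf _ _} eq x∉ = ⊥-elim (x∉ (there (here eq)))
    stay {link _}   _  _  = tt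

  defend-atSource-source-link : ∀ i ℓ b → Defended (atSource i ℓ) source (link b)
  defend-atSource-source-link i ℓ b with b Fin.≟ i
  ... | no b≢i   = swap (atSource i ℓ) tt b≢i (inj₁ (source-link b))
  ... | yes refl = defend-by-moves (atSource i ℓ) (atLinks i ℓ) ((source , link i) ∷ [])
      (here refl) ([] ∷ []) ([] ∷ [])
      ((tt , inj₁ (source-link i) , inj₁ (link-unguarded i ℓ) , tt) ∷ [])
      stay
    where
    stay : ∀ {x} → Guarded (atSource i ℓ) x → x ∉ₗ (source ∷ []) → Guarded (atLinks i ℓ) x
    stay {sink}     _  _  = tt
    stay {hub _}    _  _  = tt
    stay {leaf _ _} eq _  = eq
    stay {link _}   _  _  = tt
    stay {source}   _  x∉ = x∉ (here refl)

  defend-atSource-link-hub : ∀ i ℓ b → Defended (atSource i ℓ) (link b) (hub b)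
  defend-atSource-link-hub i ℓ b with b Fin.≟ i
  ... | no b≢i   = swap (atSource i ℓ) b≢i tt (inj₁ (link-hub b))
  ... | yes refl = defended-sym (defend-by-moves (atSource i ℓ) (atLinks j zero)
      ((hub i , link i) ∷ (leaf i ℓ , hub i) ∷ (source , link j) ∷ (link j , hub j) ∷ (hub j , leaf j zero) ∷ [])
      (here refl)
      (((λ ()) ∷ (λ ()) ∷ (λ ()) ∷ inner-≢ i≢j ∷ []) ∷ ((λ ()) ∷ (λ ()) ∷ (λ ()) ∷ []) ∷
       ((λ ()) ∷ (λ ()) ∷ []) ∷ ((λ ()) ∷ []) ∷ [] ∷ [])
      (((λ ()) ∷ inner-≢ i≢j ∷ (λ ()) ∷ (λ ()) ∷ []) ∷ ((λ ()) ∷ inner-≢ i≢j ∷ (λ ()) ∷ []) ∷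
       ((λ ()) ∷ (λ ()) ∷ []) ∷ ((λ ()) ∷ []) ∷ [] ∷ [])
      ((tt   , inj₂ (link-hub i)       , inj₁ (link-unguarded i ℓ)                        , tt) ∷
       (refl , inj₂ (hub-leaf i ℓ)     , inj₂ (here refl)                                 , tt) ∷
       (tt   , inj₁ (source-link j)    , inj₂ (there (there (there (here refl))))         , tt) ∷
       (j≢i  , inj₁ (link-hub j)       , inj₂ (there (there (there (there (here refl))))) , tt) ∷
       (tt   , inj₁ (hub-leaf j zero)  , inj₁ (inner-≢ j≢i)                              , refl) ∷ [])
      stay)
    where
    j : Fin Q
    j = proj₁ (another i)
    j≢i : j ≢ i
    j≢i = proj₂ (another i)
    i≢j : i ≢ j
    i≢j = j≢i ∘ sym
    stay : ∀ {x} → Guarded (atSource i ℓ) x → x ∉ₗ (hub i ∷ leaf i ℓ ∷ source ∷ link j ∷ hub j ∷ []) →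
           Guarded (atLinks j zero) x
    stay {sink}     _  _  = tt
    stay {hub _}    _  _  = tt
    stay {leaf _ _} eq x∉ = ⊥-elim (x∉ (there (here eq)))
    stay {link _}   _  _  = tt
    stay {source}   _  x∉ = x∉ (there (there (here refl)))

  defend-atSource-other-leaf : ∀ i ℓ ℓ′ → leaf i ℓ′ ≢ leaf i ℓ → Defended (atSource i ℓ) (hub i) (leaf i ℓ′)
  defend-atSource-other-leaf i ℓ ℓ′ new = defend-by-moves (atSource i ℓ) (atSource i ℓ′)
      ((hub i , leaf i ℓ′) ∷ (leaf i ℓ , hub i) ∷ [])
      (here refl)
      (((λ ()) ∷ []) ∷ [] ∷ [])
      (((λ ()) ∷ []) ∷ [] ∷ [])
      ((tt   , inj₁ (hub-leaf i ℓ′) , inj₁ new         , refl) ∷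
       (refl , inj₂ (hub-leaf i ℓ)  , inj₂ (here refl) , tt) ∷ [])
      stay
    where
    stay : ∀ {x} → Guarded (atSource i ℓ) x → x ∉ₗ (hub i ∷ leaf i ℓ ∷ []) → Guarded (atSource i ℓ′) x
    stay {sink}     _   _  = tt
    stay {hub _}    _   _  = tt
    stay {leaf _ _} eq  x∉ = ⊥-elim (x∉ (there (here eq)))
    stay {link _}   b≢i _  = b≢i
    stay {source}   _   _  = tt

  defend-atSource-other-gadget : ∀ i ℓ b ℓ′ → b ≢ i → Defended (atSource i ℓ) (hub b) (leaf b ℓ′)
  defend-atSource-other-gadget i ℓ b ℓ′ b≢i = defend-by-moves (atSource i ℓ) (atSource b ℓ′)
      ((hub b , leaf b ℓ′) ∷ (link b , hub b) ∷ (leaf i ℓ , hub i) ∷ (hub i , link i) ∷ [])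
      (here refl)
      (((λ ()) ∷ (λ ()) ∷ inner-≢ b≢i ∷ []) ∷ ((λ ()) ∷ (λ ()) ∷ []) ∷ ((λ ()) ∷ []) ∷ [] ∷ [])
      (((λ ()) ∷ (λ ()) ∷ (λ ()) ∷ []) ∷ (inner-≢ b≢i ∷ (λ ()) ∷ []) ∷ ((λ ()) ∷ []) ∷ [] ∷ [])
      ((tt   , inj₁ (hub-leaf b ℓ′) , inj₁ (inner-≢ b≢i)                      , refl) ∷
       (b≢i  , inj₁ (link-hub b)    , inj₂ (here refl)                         , tt) ∷
       (refl , inj₂ (hub-leaf i ℓ)  , inj₂ (there (there (there (here refl)))) , tt) ∷
       (tt   , inj₂ (link-hub i)    , inj₁ (link-unguarded i ℓ)                , b≢i ∘ sym) ∷ [])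
      stay
    where
    stay : ∀ {x} → Guarded (atSource i ℓ) x → x ∉ₗ (hub b ∷ link b ∷ leaf i ℓ ∷ hub i ∷ []) →
           Guarded (atSource b ℓ′) x
    stay {sink}     _  _  = tt
    stay {hub _}    _  _  = tt
    stay {leaf _ _} eq x∉ = ⊥-elim (x∉ (there (there (here eq))))
    stay {link _}   _  x∉ = x∉ ∘ there ∘ here ∘ cong link
    stay {source}   _  _  = tt

  defend-atSource-hub-leaf : ∀ i ℓ b ℓ′ → Defended (atSource i ℓ) (hub b) (leaf b ℓ′)
  defend-atSource-hub-leaf i ℓ b ℓ′ with leaf b ℓ′ ≟ᵥ leaf i ℓ | b Fin.≟ i
  ... | yes eq | _        = swap (atSource i ℓ) tt eq (inj₁ (hub-leaf b ℓ′))
  ... | no new | yes refl = defend-atSource-other-leaf i ℓ ℓ′ new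
  ... | no _   | no b≢i   = defend-atSource-other-gadget i ℓ b ℓ′ b≢i

  defend-atSource-leaf-sink : ∀ i ℓ b ℓ′ → Defended (atSource i ℓ) (leaf b ℓ′) sink
  defend-atSource-leaf-sink i ℓ b ℓ′ with leaf b ℓ′ ≟ᵥ leaf i ℓ
  ... | yes eq = swap (atSource i ℓ) eq tt (inj₁ (leaf-sink b ℓ′))
  ... | no new = defended-sym (defend-by-moves (atSource i ℓ) (atLinks b ℓ′)
      ((sink , leaf b ℓ′) ∷ (leaf i ℓ , sink) ∷ (source , link i) ∷ [])
      (here refl)
      (((λ ()) ∷ (λ ()) ∷ []) ∷ ((λ ()) ∷ []) ∷ [] ∷ [])
      (((λ ()) ∷ (λ ()) ∷ []) ∷ ((λ ()) ∷ []) ∷ [] ∷ [])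
      ((tt   , inj₂ (leaf-sink b ℓ′) , inj₁ new                   , refl) ∷
       (refl , inj₁ (leaf-sink i ℓ)  , inj₂ (here refl)           , tt) ∷
       (tt   , inj₁ (source-link i)  , inj₁ (link-unguarded i ℓ)  , tt) ∷ [])
      stay)
    where
    stay : ∀ {x} → Guarded (atSource i ℓ) x → x ∉ₗ (sink ∷ leaf i ℓ ∷ source ∷ []) →
           Guarded (atLinks b ℓ′) x
    stay {sink}     _  _  = tt
    stay {hub _}    _  _  = tt
    stay {leaf _ _} eq x∉ = ⊥-elim (x∉ (there (here eq)))
    stay {link _}   _  _  = tt
    stay {source}   _  x∉ = x∉ (there (there (here refl)))

  defend : ∀ c {a b} → Edge a b → Defended c a b
  defend (atLinks i ℓ)  (source-link b) = defend-atLinks-source-link i ℓ b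
  defend (atLinks i ℓ)  (link-hub b)    = swap (atLinks i ℓ) tt tt (inj₁ (link-hub b))
  defend (atLinks i ℓ)  (hub-leaf b ℓ′) = defend-atLinks-hub-leaf i ℓ b ℓ′
  defend (atLinks i ℓ)  (leaf-sink b ℓ′) = defend-atLinks-leaf-sink i ℓ b ℓ′
  defend (atSource i ℓ) (source-link b) = defend-atSource-source-link i ℓ b
  defend (atSource i ℓ) (link-hub b)    = defend-atSource-link-hub i ℓ b
  defend (atSource i ℓ) (hub-leaf b ℓ′) = defend-atSource-hub-leaf i ℓ b ℓ′
  defend (atSource i ℓ) (leaf-sink b ℓ′) = defend-atSource-leaf-sink i ℓ b ℓ′

  defend-adjacent : ∀ c {a b} → Adjacent a b → Defended c a b
  defend-adjacent c (inj₁ ab) = defend c ab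
  defend-adjacent c (inj₂ ba) = defended-sym (defend c ba)

  IsConfigCover : Subset (n G) → Set
  IsConfigCover U = ∃ λ c → U ≡ cover c

  defended⇒defense : ∀ c {u v} → Defended c (dec u) (dec v) →
                     ∃ λ φ → Defense G (cover c) u v φ × ∃ λ U′ → IsConfigCover U′ × IsImage (cover c) φ U′
  defended⇒defense c {u} {v} (defended φ defense c′ image) =
    φ , subst₂ (λ x y → Defense G (cover c) x y φ) (enc-dec u) (enc-dec v) defense , cover c′ , (c′ , refl) , image

  evc-class : IsEVCClass G (2 + (Q + Q)) IsConfigCover
  evc-class = (cover (atLinks zero zero) , atLinks zero zero , refl) ,
              (λ { _ (c , refl) → cover-covers c , ∣cover∣ c }) ,
              λ { _ (c , refl) u v uv → defended⇒defense c (defend-adjacent c (adj⇒adjacent uv)) }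

-- Unnormalised rationals compute their numerators and denominators, so the bound is the
-- cross-multiplied ℕ inequality (2k + 2)(k + 4) ≤ (2k + 6)(k + 2).
ratio-bound : ∀ k → let Q = 2 + k in ((+ 2 / 1 - + 2 / Q) * (+ (2 + Q) / 1)) ≤ℚ (+ (2 + (Q + Q)) / 1)
ratio-bound k =
  toℚᵘ-cancel-≤ (ℚᵘ.≤-respˡ-≃ (ℚᵘ.≃-sym lhs≃) (ℚᵘ.≤-respʳ-≃ (ℚᵘ.≃-sym (toℚᵘ-fromℚᵘ rhs)) lhs≤rhs))
  where
  Q : ℕ
  Q = 2 + k

  two two/Q 2+Q rhs : ℚᵘ.ℚᵘ
  two   = ℚᵘ.mkℚᵘ (+ 2) 0
  two/Q = ℚᵘ.mkℚᵘ (+ 2) (suc k)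
  2+Q   = ℚᵘ.mkℚᵘ (+ (2 + Q)) 0
  rhs   = ℚᵘ.mkℚᵘ (+ (2 + (Q + Q))) 0

  lhs≃ : toℚᵘ ((fromℚᵘ two - fromℚᵘ two/Q) * fromℚᵘ 2+Q) ℚᵘ.≃ (two ℚᵘ.- two/Q) ℚᵘ.* 2+Q
  lhs≃ = ℚᵘ.≃-trans (toℚᵘ-homo-* (fromℚᵘ two - fromℚᵘ two/Q) (fromℚᵘ 2+Q))
           (ℚᵘ.*-cong (ℚᵘ.≃-trans (toℚᵘ-homo-+ (fromℚᵘ two) (ℚ.- fromℚᵘ two/Q))
                                  (ℚᵘ.+-cong (toℚᵘ-fromℚᵘ two) two/Q≃))
                      (toℚᵘ-fromℚᵘ 2+Q))
    where
    two/Q≃ : toℚᵘ (ℚ.- fromℚᵘ two/Q) ℚᵘ.≃ ℚᵘ.- two/Q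
    two/Q≃ = ℚᵘ.≃-trans (toℚᵘ-homo‿- (fromℚᵘ two/Q)) (ℚᵘ.-‿cong (toℚᵘ-fromℚᵘ two/Q))

  cross-multiplied : ∀ k → (k + 1 ℕ.* (2 + k)) ℕ.* (2 + (2 + k)) ℕ.* 1 + 4 ≡
                           (2 + ((2 + k) + (2 + k))) ℕ.* ((1 ℕ.* (2 + k)) ℕ.* 1)
  cross-multiplied = solve-∀

  lhs≤rhs : (two ℚᵘ.- two/Q) ℚᵘ.* 2+Q ℚᵘ.≤ rhs
  lhs≤rhs = ℚᵘ.*≤* (subst₂ ℤ._≤_
    (trans (pos-* ((k + 1 ℕ.* Q) ℕ.* (2 + Q)) 1) (cong (ℤ._* + 1) (pos-* (k + 1 ℕ.* Q) (2 + Q))))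
    (pos-* (2 + (Q + Q)) ((1 ℕ.* Q) ℕ.* 1))
    (+≤+ (≤-trans (m≤m+n _ 4) (≤-reflexive (cross-multiplied k)))))

lemma16 : (k : ℕ) → Σ SP λ t → Biconnected (spGraph t) ×
    (Σ ℕ λ vc → Σ ℕ λ evc →
    IsVCNumber (spGraph t) vc × IsEVCNumber (spGraph t) evc ×
    k + vc ≤ evc ×
    ((+ 2 / 1 - + 2 / (2 + k)) * (+ vc / 1)) ≤ℚ (+ evc / 1))
lemma16 k =
  gadgets (suc k) , biconnected , 2 + Q , 2 + (Q + Q) ,
  vc-number (s≤s (s≤s (m≤m+n Q Q))) , ((IsConfigCover , evc-class) , evc-lower ≤-refl) ,
  ≤-trans (m≤m+n _ 2) (≤-reflexive (gap k)) , ratio-bound k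
  where
  Q m : ℕ
  Q = 2 + k
  -- a gadget has 2 + 2Q leaves: no vertex cover of size below 2 + 2Q guards all of them
  m = suc (Q + Q)

  gap : ∀ k → k + (2 + (2 + k)) + 2 ≡ 2 + ((2 + k) + (2 + k))
  gap = solve-∀

  open Gadgets m using (gadgets)
  open Biconnectivity m k using (biconnected)
  open VertexCoverNumber m (suc k) using (vc-number)
  open EternalClass m k using (IsConfigCover; evc-class)
  open EternalLowerBound m (suc k) using (evc-lower)
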